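{- Consider a deterministic machine that performs a lossless compression algorithm in the read/write streams model using only one stream. Let the input be $s=xty$ with $t$ a substring occupying a fixed part (interval of cells) of the stream. Then $t$ is uniquely determined (among all strings of length $|t|$ placed in that same position, with $x$ and $y$ fixed) by: its length $|t|$; for each pass, the machine's internal memory configurations at the moments it reaches and leaves the part of the stream that initially holds $t$; and all the output the machine produces while its head is over that part.
   Context: Read/write streams model: an algorithm has an internal memory of $m$ bits and access to a fixed number of streams (tapes); each stream is a sequence of cells accessed sequentially by a read/write head; a pass is one sequential sweep over a stream. The input string is initially on the stream. A compression algorithm is lossless if its complete output determines the input. -}

module Defs where

open import Data.Nat using (ℕ; zero; suc; _+_; _≤ᵇ_; _<ᵇ_; _≡ᵇ_)
open import Data.Bool using (Bool; true; false; _∧_; if_then_else_)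
open import Data.List using (List; []; _∷_; _++_; length; concatMap; map)
open import Data.Vec using (Vec)
open import Data.Maybe using (Maybe; just; nothing)
open import Data.Product using (_×_; _,_; ∃)
open import Relation.Binary.PropositionalEquality using (_≡_)

data Move : Set where
  L R : Move

-- A deterministic machine in the read/write streams model with ONE stream.
--   m    : number of bits of internal memory (memory configurations = Vec Bool m)
--   Σ    : input alphabet, Γ : cell alphabet of the stream, O : output alphabet
--   δ    : transition: from the current memory and the symbol under the head,
--          either halt (nothing) or give new memory, symbol written, output emitted
--   dir  : the current head direction is part of the memory configuration
--   q₀   : initial memory configuration
record Machine (m : ℕ) (Σ Γ O : Set) : Set where
  field
    blank : Γ
    embed : Σ → Γ
    q₀    : Vec Bool m
    δ     : Vec Bool m → Γ → Maybe (Vec Bool m × Γ × List O)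
    dir   : Vec Bool m → Move

Mem : ℕ → Set
Mem m = Vec Bool m

record Config (m : ℕ) (Γ : Set) : Set where
  constructor cfg
  field
    mem  : Mem m
    pos  : ℕ
    tape : ℕ → Γ

record StepRec (m : ℕ) (O : Set) : Set where
  constructor srec
  field
    from  : ℕ
    to    : ℕ
    mem'  : Mem m
    out   : List O

move : Move → ℕ → ℕ
move L zero    = zero
move L (suc p) = p
move R p       = suc p

write : {Γ : Set} → (ℕ → Γ) → ℕ → Γ → ℕ → Γ
write τ p c i = if i ≡ᵇ p then c else τ i

module _ {m : ℕ} {Σ Γ O : Set} (M : Machine m Σ Γ O) where
  open Machine M

  initTape : List Σ → ℕ → Γ
  initTape []       _       = blank
  initTape (a ∷ s)  zero    = embed a
  initTape (a ∷ s)  (suc i) = initTape s i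

  initConfig : List Σ → Config m Γ
  initConfig s = cfg q₀ zero (initTape s)

  step : Config m Γ → Maybe (Config m Γ × StepRec m O)
  step (cfg q p τ) with δ q (τ p)
  ... | nothing = nothing
  ... | just (q' , c , o) =
        just (cfg q' (move (dir q') p) (write τ p c) , srec p (move (dir q') p) q' o)

  -- run n c ≡ just tr : the machine halts within n steps from c, tr = its steps
  run : ℕ → Config m Γ → Maybe (List (StepRec m O))
  run zero    c = nothing
  run (suc n) c with step c
  ... | nothing = just []
  ... | just (c' , r) with run n c'
  ...   | nothing = nothing
  ...   | just rs = just (r ∷ rs)

  output : List (StepRec m O) → List O
  output = concatMap StepRec.out

  Outputs : List Σ → List O → Set
  Outputs s o = ∃ λ n → ∃ λ tr → (run n (initConfig s) ≡ just tr) × (output tr ≡ o)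

  Lossless : Set
  Lossless = ((s : List Σ) → ∃ λ o → Outputs s o)
           × ((s s' : List Σ) (o : List O) → Outputs s o → Outputs s' o → s ≡ s')

data Event (m : ℕ) (O : Set) : Set where
  reach : Mem m → Event m O
  leave : Mem m → Event m O
  emit  : O → Event m O

inPart : ℕ → ℕ → ℕ → Bool
inPart lo len p = (lo ≤ᵇ p) ∧ (p <ᵇ lo + len)

stepEvents : {m : ℕ} {O : Set} → ℕ → ℕ → StepRec m O → List (Event m O)
stepEvents lo len (srec p p' q' o) with inPart lo len p | inPart lo len p'
... | true  | true  = map emit o
... | true  | false = map emit o ++ (leave q' ∷ [])
... | false | true  = reach q' ∷ []
... | false | false = []

-- The transcript of a run w.r.t. the part [lo, lo+len): in chronological order,
-- memory configurations at reaching/leaving the part and output produced over it.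
-- (If the head starts on the part, the initial memory counts as a "reach".)
transcript : {m : ℕ} {O : Set} → Mem m → ℕ → ℕ → List (StepRec m O) → List (Event m O)
transcript q₀ lo len tr =
  (if inPart lo len zero then reach q₀ ∷ [] else []) ++ concatMap (stepEvents lo len) tr

-- Outside the part the two runs read the same cells, so they move in lockstep.
-- Once the head enters the part, everything emitted before it leaves is recorded
-- in the transcript, and so is the memory at the moment of leaving; that memory
-- fixes the head direction and hence the cell where the head reappears outside,
-- and writes made inside the part never change the tape outside it.  So equal
-- transcripts force equal outputs, and losslessness turns equal outputs into
-- equal inputs.
module Submission where

open import Defs
open import Data.Nat using (ℕ; zero; suc; pred; _+_; _≤_; _<_; _≡ᵇ_; _≤?_; _<?_)
open import Data.Nat.Properties
  using (≤ᵇ⇒≤; ≤⇒≤ᵇ; <ᵇ⇒<; <⇒<ᵇ; ≡ᵇ⇒≡; ≰⇒>; ≮⇒≥; <⇒≱; ≤-antisym; ≤-trans; n≤1+n; n<1+n; m<n⇒m<1+n; suc-injective)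
open import Data.Nat.Induction using (<-wellFounded)
open import Induction.WellFounded using (Acc; acc)
open import Data.Bool using (true; false)
open import Data.Bool.Properties using (T-≡; T-∧)
open import Data.Maybe using (just; nothing)
open import Data.Maybe.Properties using (just-injective)
open import Data.List using (List; []; _∷_; _++_; length; map; concatMap)
open import Data.List.Properties using (++-assoc; ++-cancelˡ; ++-cancelʳ; map-++; map-injective; ∷-injective; ∷-injectiveʳ)
open import Data.Product using (_×_; _,_)
open import Data.Sum using (_⊎_; inj₁; inj₂)
open import Function.Bundles using (Equivalence)
open import Relation.Nullary using (yes; no; contradiction)
open import Relation.Binary.PropositionalEquality
  using (_≡_; _≢_; refl; sym; trans; cong; cong₂; subst; module ≡-Reasoning)

inPart-suc : ∀ lo len i → inPart (suc lo) len (suc i) ≡ inPart lo len i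
inPart-suc zero     len i = refl
inPart-suc (suc lo) len i = refl

module Part (lo len : ℕ) where

  inPart-intro : ∀ {p} → lo ≤ p → p < lo + len → inPart lo len p ≡ true
  inPart-intro lo≤p p<hi =
    Equivalence.to T-≡ (Equivalence.from T-∧ (≤⇒≤ᵇ lo≤p , <⇒<ᵇ p<hi))

  inPart-elim : ∀ {p} → inPart lo len p ≡ true → lo ≤ p × p < lo + len
  inPart-elim {p} p∈ with Equivalence.to T-∧ (Equivalence.from T-≡ p∈)
  ... | lo≤ᵇp , p<ᵇhi = ≤ᵇ⇒≤ lo p lo≤ᵇp , <ᵇ⇒< p (lo + len) p<ᵇhi

  ¬inPart-elim : ∀ {p} → inPart lo len p ≡ false → p < lo ⊎ lo + len ≤ p
  ¬inPart-elim {p} p∉ with lo ≤? p | p <? lo + len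
  ... | no lo≰p   | _         = inj₁ (≰⇒> lo≰p)
  ... | yes _     | no p≮hi   = inj₂ (≮⇒≥ p≮hi)
  ... | yes lo≤p  | yes p<hi  with () ← trans (sym (inPart-intro lo≤p p<hi)) p∉

  -- For L and lo = 0 this is junk, but the head can never leave the part that way.
  beyond : Move → ℕ
  beyond L = pred lo
  beyond R = lo + len

  move-leaving : ∀ d p → inPart lo len p ≡ true → inPart lo len (move d p) ≡ false →
                 move d p ≡ beyond d
  move-leaving R p p∈ p'∉ with inPart-elim p∈ | ¬inPart-elim p'∉
  ... | lo≤p , _    | inj₁ 1+p<lo = contradiction (≤-trans lo≤p (n≤1+n p)) (<⇒≱ 1+p<lo)
  ... | _ , 1+p≤hi  | inj₂ hi≤1+p = ≤-antisym 1+p≤hi hi≤1+p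
  move-leaving L zero p∈ p'∉ with () ← trans (sym p∈) p'∉
  move-leaving L (suc k) p∈ p'∉ with inPart-elim p∈ | ¬inPart-elim p'∉
  ... | lo≤1+k , _  | inj₁ k<lo   = cong pred (≤-antisym k<lo lo≤1+k)
  ... | _ , 1+k<hi  | inj₂ hi≤k   = contradiction (≤-trans hi≤k (n≤1+n k)) (<⇒≱ 1+k<hi)

  AgreeOff : {A : Set} → (ℕ → A) → (ℕ → A) → Set
  AgreeOff τ τ' = ∀ i → inPart lo len i ≡ false → τ i ≡ τ' i

  module _ {A : Set} where

    agreeOff-sym : {τ τ' : ℕ → A} → AgreeOff τ τ' → AgreeOff τ' τ
    agreeOff-sym agree i i∉ = sym (agree i i∉)

    agreeOff-trans : {τ τ' τ'' : ℕ → A} → AgreeOff τ τ' → AgreeOff τ' τ'' → AgreeOff τ τ''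
    agreeOff-trans agree agree' i i∉ = trans (agree i i∉) (agree' i i∉)

    write-inside : ∀ (τ : ℕ → A) {p} c → inPart lo len p ≡ true → AgreeOff τ (write τ p c)
    write-inside τ {p} c p∈ i i∉ with i ≡ᵇ p in i≡ᵇp
    ... | false = refl
    ... | true with refl ← ≡ᵇ⇒≡ i p (Equivalence.from T-≡ i≡ᵇp)
               with () ← trans (sym p∈) i∉

    write-cong : ∀ {τ τ' : ℕ → A} p c → AgreeOff τ τ' → AgreeOff (write τ p c) (write τ' p c)
    write-cong p c agree i i∉ with i ≡ᵇ p
    ... | true  = refl
    ... | false = agree i i∉

module _ {m : ℕ} {O : Set} where

  emit-injective : {o o' : O} → emit {m} o ≡ emit o' → o ≡ o'
  emit-injective refl = refl

  emits≢emits++leave : ∀ (xs ys : List O) {q : Mem m} {es} →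
                       map emit xs ≢ map emit ys ++ leave q ∷ es
  emits≢emits++leave []       []       ()
  emits≢emits++leave []       (_ ∷ _)  ()
  emits≢emits++leave (_ ∷ _)  []       ()
  emits≢emits++leave (_ ∷ xs) (_ ∷ ys) eq = emits≢emits++leave xs ys (∷-injectiveʳ eq)

  emits++leave-injective : ∀ (xs ys : List O) {q q' : Mem m} {es es'} →
    map emit xs ++ leave q ∷ es ≡ map emit ys ++ leave q' ∷ es' → xs ≡ ys × q ≡ q' × es ≡ es'
  emits++leave-injective []       []       refl = refl , refl , refl
  emits++leave-injective []       (_ ∷ _)  ()
  emits++leave-injective (_ ∷ _)  []       ()
  emits++leave-injective (_ ∷ xs) (_ ∷ ys) eq with ∷-injective eq
  ... | refl , eq' with emits++leave-injective xs ys eq'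
  ...   | refl , refl , refl = refl , refl , refl

module _ {m : ℕ} {Σ Γ O : Set} (M : Machine m Σ Γ O) where
  open Machine M

  data Halts : Config m Γ → List (StepRec m O) → Set where
    halt : ∀ {q p τ} → δ q (τ p) ≡ nothing → Halts (cfg q p τ) []
    next : ∀ {q p τ q' c o rs} → δ q (τ p) ≡ just (q' , c , o) →
           Halts (cfg q' (move (dir q') p) (write τ p c)) rs →
           Halts (cfg q p τ) (srec p (move (dir q') p) q' o ∷ rs)

  run⇒Halts : ∀ n {c tr} → run M n c ≡ just tr → Halts c tr
  run⇒Halts (suc n) {cfg q p τ} ran with δ q (τ p) in stuck
  ... | nothing with refl ← ran = halt stuck
  ... | just (q' , c , o) with run M n (cfg q' (move (dir q') p) (write τ p c)) in ran'
  ...   | just rs with refl ← ran = next stuck (run⇒Halts n ran')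

  initTape-agreeOff : ∀ x t t' y → length t ≡ length t' →
    Part.AgreeOff (length x) (length t) (initTape M (x ++ t ++ y)) (initTape M (x ++ t' ++ y))
  initTape-agreeOff []      []      []       y _    i       _   = refl
  initTape-agreeOff []      (_ ∷ t) (_ ∷ t') y |t|≡ zero    ()
  initTape-agreeOff []      (_ ∷ t) (_ ∷ t') y |t|≡ (suc i) i∉  =
    initTape-agreeOff [] t t' y (suc-injective |t|≡) i i∉
  initTape-agreeOff (_ ∷ x) t       t'       y |t|≡ zero    _   = refl
  initTape-agreeOff (_ ∷ x) t       t'       y |t|≡ (suc i) i∉  =
    initTape-agreeOff x t t' y |t|≡ i (trans (sym (inPart-suc (length x) (length t) i)) i∉)

  module Crossing (lo len : ℕ) where
    open Part lo len

    events : List (StepRec m O) → List (Event m O)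
    events = concatMap (stepEvents lo len)

    transcript-events : ∀ q tr tr' → transcript q lo len tr ≡ transcript q lo len tr' →
                        events tr ≡ events tr'
    transcript-events q _ _ = ++-cancelˡ _ _ _

    stepEvents-within : ∀ {p p'} {q : Mem m} {o : List O} →
      inPart lo len p ≡ true → inPart lo len p' ≡ true →
      stepEvents lo len (srec p p' q o) ≡ map emit o
    stepEvents-within p∈ p'∈ rewrite p∈ | p'∈ = refl

    stepEvents-leaving : ∀ {p p'} {q : Mem m} {o : List O} →
      inPart lo len p ≡ true → inPart lo len p' ≡ false →
      stepEvents lo len (srec p p' q o) ≡ map emit o ++ leave q ∷ []
    stepEvents-leaving p∈ p'∉ rewrite p∈ | p'∉ = refl

    data Aligned : Config m Γ → Config m Γ → Set where
      outside : ∀ {q p τ τ'} → inPart lo len p ≡ false → Aligned (cfg q p τ) (cfg q p τ')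
      inside  : ∀ {c c'} → inPart lo len (Config.pos c) ≡ true →
                inPart lo len (Config.pos c') ≡ true → Aligned c c'

    aligned-refl : ∀ q p {τ τ'} → Aligned (cfg q p τ) (cfg q p τ')
    aligned-refl q p with inPart lo len p in p∈?
    ... | true  = inside p∈? p∈?
    ... | false = outside p∈?

    -- A run started inside the part either never leaves it, or reappears beyond it
    -- with the tape changed only inside the part.
    data Sojourn (τ : ℕ → Γ) (tr : List (StepRec m O)) : Set where
      stays  : events tr ≡ map emit (output M tr) → Sojourn τ tr
      leaves : ∀ {q τ' rest} (os : List O) →
               Halts (cfg q (beyond (dir q)) τ') rest → length rest < length tr →
               inPart lo len (beyond (dir q)) ≡ false → AgreeOff τ τ' →
               events tr ≡ map emit os ++ leave q ∷ events rest →
               output M tr ≡ os ++ output M rest → Sojourn τ tr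

    sojourn : ∀ {q p τ tr} → inPart lo len p ≡ true → Halts (cfg q p τ) tr → Sojourn τ tr
    sojourn _ (halt _) = stays refl
    sojourn {p = p} {τ} p∈ (next {q' = q'} {c} {o} {rs} _ halts)
      with inPart lo len (move (dir q') p) in p'∈?
    ... | false =
      leaves o (subst (λ p' → Halts (cfg q' p' (write τ p c)) rs) exit halts) (n<1+n _)
        (subst (λ p' → inPart lo len p' ≡ false) exit p'∈?) (write-inside τ c p∈)
        (trans (cong (_++ events rs) (stepEvents-leaving p∈ p'∈?))
               (++-assoc (map emit o) (leave q' ∷ []) (events rs)))
        refl
      where exit = move-leaving (dir q') p p∈ p'∈?
    ... | true with sojourn p'∈? halts
    ...   | stays evs =
      stays (trans (cong₂ _++_ (stepEvents-within p∈ p'∈?) evs) (sym (map-++ emit o _)))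
    ...   | leaves {q''} {rest = rest} os halts' shorter p''∉ agree evs outs =
      leaves (o ++ os) halts' (m<n⇒m<1+n shorter) p''∉
        (agreeOff-trans (write-inside τ c p∈) agree) evs'
        (trans (cong (o ++_) outs) (sym (++-assoc o os _)))
      where
        open ≡-Reasoning
        evs' : events (srec p (move (dir q') p) q' o ∷ rs)
             ≡ map emit (o ++ os) ++ leave q'' ∷ events rest
        evs' = begin
          stepEvents lo len (srec p (move (dir q') p) q' o) ++ events rs
            ≡⟨ cong₂ _++_ (stepEvents-within p∈ p'∈?) evs ⟩
          map emit o ++ map emit os ++ leave q'' ∷ events rest
            ≡⟨ sym (++-assoc (map emit o) (map emit os) _) ⟩
          (map emit o ++ map emit os) ++ leave q'' ∷ events rest
            ≡⟨ cong (_++ leave q'' ∷ events rest) (sym (map-++ emit o os)) ⟩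
          map emit (o ++ os) ++ leave q'' ∷ events rest
            ∎

    outputs-agree : ∀ {c c' tr tr'} → Acc _<_ (length tr) → Halts c tr → Halts c' tr' →
      AgreeOff (Config.tape c) (Config.tape c') → Aligned c c' →
      events tr ≡ events tr' → output M tr ≡ output M tr'
    outputs-agree _ (halt _) (halt _) _ (outside _) _ = refl
    outputs-agree _ (halt stuck) (next moves _) agree (outside {q} {p} p∉) _
      with () ← trans (sym stuck) (trans (cong (δ q) (agree p p∉)) moves)
    outputs-agree _ (next moves _) (halt stuck) agree (outside {q} {p} p∉) _
      with () ← trans (sym stuck) (trans (cong (δ q) (sym (agree p p∉))) moves)
    outputs-agree (acc rec) (next {o = o} moves halts) (next moves' halts') agree
                  (outside {q} {p} p∉) evs
      with refl ← just-injective (trans (sym moves) (trans (cong (δ q) (agree p p∉)) moves'))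
      = cong (o ++_) (outputs-agree (rec (n<1+n _)) halts halts' (write-cong p _ agree)
                        (aligned-refl _ _) (++-cancelˡ _ _ _ evs))
    outputs-agree (acc rec) halts halts' agree (inside p∈ p∈') evs
      with sojourn p∈ halts | sojourn p∈' halts'
    ... | stays e | stays e' = map-injective emit-injective (trans (sym e) (trans evs e'))
    ... | stays e | leaves os' _ _ _ _ e' _ =
      contradiction (trans (sym e) (trans evs e')) (emits≢emits++leave _ os')
    ... | leaves os _ _ _ _ e _ | stays e' =
      contradiction (trans (sym e') (trans (sym evs) e)) (emits≢emits++leave _ os)
    ... | leaves os halts₁ shorter p∉ back e outs | leaves os' halts₁' _ _ back' e' outs'
      with emits++leave-injective os os' (trans (sym e) (trans evs e'))
    ...   | refl , refl , rest-evs =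
      trans outs (trans (cong (os ++_) rests-agree) (sym outs'))
      where
        rests-agree = outputs-agree (rec shorter) halts₁ halts₁'
          (agreeOff-trans (agreeOff-sym back) (agreeOff-trans agree back'))
          (outside p∉) rest-evs

lemma2 : ∀ {m : ℕ} {Σ Γ O : Set} (M : Machine m Σ Γ O) → Lossless M →
    (x t t' y : List Σ) → length t ≡ length t' →
    (n n' : ℕ) (tr tr' : List (StepRec m O)) →
    run M n (initConfig M (x ++ t ++ y)) ≡ just tr →
    run M n' (initConfig M (x ++ t' ++ y)) ≡ just tr' →
    transcript (Machine.q₀ M) (length x) (length t) tr
      ≡ transcript (Machine.q₀ M) (length x) (length t') tr' →
    t ≡ t'
lemma2 M (_ , determines) x t t' y |t|≡ n n' tr tr' ran ran' same-transcript =
  ++-cancelʳ y t t' (++-cancelˡ x _ _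
    (determines _ _ (output M tr) (n , tr , ran , refl) (n' , tr' , ran' , sym same-output)))
  where
    open Machine M using (q₀)
    open Crossing M (length x) (length t)
    |t|-transcript : transcript q₀ (length x) (length t) tr ≡ transcript q₀ (length x) (length t) tr'
    |t|-transcript = subst (λ l → transcript q₀ (length x) (length t) tr ≡ transcript q₀ (length x) l tr')
                           (sym |t|≡) same-transcript
    same-output : output M tr ≡ output M tr'
    same-output =
      outputs-agree (<-wellFounded _) (run⇒Halts M n ran) (run⇒Halts M n' ran')
        (initTape-agreeOff M x t t' y |t|≡) (aligned-refl _ 0)
        (transcript-events q₀ tr tr' |t|-transcript)
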